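{- The repeated step algorithm with groups of $3$ (described in the context) correctly returns the $i$th smallest element of its input and runs in $\Theta(n)$ worst-case time on any $n$-element input.
   Context: Selection problem: given a sequence $A$ of $n$ distinct numbers and an integer $1\le i\le n$, output the $i$th smallest element of $A$; floors and ceilings are ignored in the description and analysis (group counts such as $n/3$, $n/9$ are treated as exact). Running time is in the RAM model with unit-cost comparisons. The repeated step algorithm on input $(A,n,i)$: (1) If $n\le 3$, sort $A$ and return the $i$th smallest number. (2) Arrange $A$ into disjoint groups of size $3$; let $M$ be the sequence of the medians of these $n/3$ groups. (3) Arrange $M$ into disjoint groups of size $3$; let $M'$ be the sequence of the medians of these $n/9$ groups. (4) Recursively (using this same algorithm) select the median of $M'$; call it $m$. (5) Partition $A$ into $A_1=\{x\in A: x<m\}$ and $A_2=\{x\in A: x>m\}$. If $|A_1|=i-1$, return $m$; if $|A_1|>i-1$, go to step (1) with $A\leftarrow A_1$, $n\leftarrow |A_1|$; otherwise go to step (1) with $A\leftarrow A_2$, $n\leftarrow|A_2|$, $i\leftarrow i-|A_1|-1$. -}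

module Defs where

open import Level using (0ℓ)
open import Data.Nat using (ℕ; zero; suc; _+_; _∸_; _≤ᵇ_; ⌈_/2⌉)
open import Data.Nat.Properties using (<-cmp)
open import Data.Product using (_×_; _,_)
open import Data.Maybe using (Maybe; just; nothing)
open import Data.List using (List; []; _∷_; length)
open import Data.Bool using (true; false)
open import Relation.Binary using (Tri; tri<; tri≈; tri>)
open import Relation.Binary.Bundles using (StrictTotalOrder)

-- The repeated step selection algorithm (groups of 3), instrumented to
-- count element comparisons (unit cost per three-way comparison).
-- Elements come from an arbitrary strict total order; indices i are 1-based.
module RepeatedStep (O : StrictTotalOrder 0ℓ 0ℓ 0ℓ) where
  open StrictTotalOrder O renaming (Carrier to C)

  insert : C → List C → List C × ℕ
  insert x [] = (x ∷ [] , 0)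
  insert x (y ∷ ys) with compare x y
  ... | tri< _ _ _ = (x ∷ y ∷ ys , 1)
  ... | tri≈ _ _ _ = (x ∷ y ∷ ys , 1)
  ... | tri> _ _ _ with insert x ys
  ...   | (zs , k) = (y ∷ zs , suc k)

  isort : List C → List C × ℕ
  isort [] = ([] , 0)
  isort (x ∷ xs) with isort xs
  ... | (ys , k) with insert x ys
  ...   | (zs , k′) = (zs , k + k′)

  nth : List C → ℕ → Maybe C
  nth [] _ = nothing
  nth (x ∷ xs) zero = nothing
  nth (x ∷ xs) (suc zero) = just x
  nth (x ∷ xs) (suc (suc i)) = nth xs (suc i)

  -- median of {lo, hi, c} given lo < hi (at most 2 further comparisons)
  medianSorted : C → C → C → C × ℕ
  medianSorted lo hi c with compare hi c
  ... | tri< _ _ _ = (hi , 1)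
  ... | tri≈ _ _ _ = (hi , 1)
  ... | tri> _ _ _ with compare lo c
  ...   | tri< _ _ _ = (c , 2)
  ...   | tri≈ _ _ _ = (c , 2)
  ...   | tri> _ _ _ = (lo , 2)

  median3 : C → C → C → C × ℕ
  median3 a b c with compare a b
  ... | tri< _ _ _ with medianSorted a b c
  ...   | (m , k) = (m , suc k)
  median3 a b c | tri≈ _ _ _ with medianSorted b a c
  ...   | (m , k) = (m , suc k)
  median3 a b c | tri> _ _ _ with medianSorted b a c
  ...   | (m , k) = (m , suc k)

  median2 : C → C → C × ℕ
  median2 a b with compare a b
  ... | tri< _ _ _ = (a , 1)
  ... | tri≈ _ _ _ = (a , 1)
  ... | tri> _ _ _ = (b , 1)

  medians : List C → List C × ℕ
  medians (a ∷ b ∷ c ∷ rest) with median3 a b c | medians rest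
  ... | (m , k) | (ms , k′) = (m ∷ ms , k + k′)
  medians (a ∷ b ∷ []) with median2 a b
  ... | (m , k) = (m ∷ [] , k)
  medians (a ∷ []) = (a ∷ [] , 0)
  medians [] = ([] , 0)

  partition : C → List C → List C × List C × ℕ
  partition m [] = ([] , [] , 0)
  partition m (x ∷ xs) with partition m xs
  ... | (l , r , k) with compare x m
  ...   | tri< _ _ _ = (x ∷ l , r , suc k)
  ...   | tri≈ _ _ _ = (l , r , suc k)
  ...   | tri> _ _ _ = (l , x ∷ r , suc k)

  -- the algorithm with a fuel argument (to make termination structural);
  -- returns the selected element and the total number of comparisons,
  -- or nothing if fuel ran out / the index is out of range.
  selectF : ℕ → List C → ℕ → Maybe (C × ℕ)
  selectF zero _ _ = nothing
  selectF (suc f) xs i with length xs ≤ᵇ 3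
  ... | true with isort xs
  ...   | (ys , k) with nth ys i
  ...     | nothing = nothing
  ...     | just r = just (r , k)
  selectF (suc f) xs i | false with medians xs
  ... | (M , k₁) with medians M
  ...   | (M′ , k₂) with selectF f M′ ⌈ length M′ /2⌉
  ...     | nothing = nothing
  ...     | just (m , k₃) with partition m xs
  ...       | (A₁ , A₂ , k₄) with <-cmp (length A₁) (i ∸ 1)
  ...         | tri≈ _ _ _ = just (m , k₁ + k₂ + k₃ + k₄)
  ...         | tri> _ _ _ with selectF f A₁ i
  ...           | nothing = nothing
  ...           | just (r , k₅) = just (r , k₁ + k₂ + k₃ + k₄ + k₅)
  selectF (suc f) xs i | false | (M , k₁) | (M′ , k₂) | just (m , k₃) | (A₁ , A₂ , k₄) | tri< _ _ _
    with selectF f A₂ (i ∸ length A₁ ∸ 1)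
  ... | nothing = nothing
  ... | just (r , k₅) = just (r , k₁ + k₂ + k₃ + k₄ + k₅)

  -- top-level call: fuel = n suffices since every recursive call is on a
  -- strictly shorter list (for n ≥ 4)
  select : List C → ℕ → Maybe (C × ℕ)
  select xs i = selectF (length xs) xs i

open RepeatedStep public using (select)

module Submission where

-- A round on n ≥ 4 elements takes the medians M of the groups of three of
-- xs, the medians M′ of the groups of three of M, and recursively selects
-- the median m of the k = |M′| ≥ n/9 elements of M′.  The key fact
-- (pivot-balanced) is a majority counting argument applied twice: for a
-- predicate closed upwards (or downwards) in the order, at least half the
-- groups whose median satisfies it contribute two satisfying elements, so
-- each side of the partition around m has at most n + 3 - 2k elements.
-- The cost recurrence T(n) ≤ 3n + T(k) + T(n + 3 - 2k) then gives
-- T(n) ≤ 108n (round-cost), while the partition alone costs n.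

open import Level using (0ℓ)
open import Data.Bool using (true; false; if_then_else_)
open import Data.Maybe using (Maybe; just)
open import Data.Nat using (ℕ; zero; suc; _+_; _*_; _∸_; _≤_; _<_; z≤n; s≤s; ⌊_/2⌋; ⌈_/2⌉; _≤?_; _≤ᵇ_)
open import Data.Nat.Properties
  using ( +-commutativeSemigroup; +-comm; +-suc; +-identityʳ; *-suc; *-assoc; *-identityˡ
        ; *-distribˡ-+; ≤-refl; ≤-trans; ≤-reflexive; ≤-pred; <⇒≤; <⇒≱; ≰⇒>; <-cmp; m≤n⇒m≤1+n
        ; +-mono-≤; +-monoˡ-≤; +-monoʳ-≤; *-monoʳ-≤; +-cancelˡ-≤; +-cancelʳ-≤; m≤m+n; m≤n+m
        ; m∸n+n≡m; ≤ᵇ⇒≤; ≤⇒≤ᵇ; ⌈n/2⌉≤n; ⌈n/2⌉-mono; ⌊n/2⌋+⌈n/2⌉≡n; ⌊n/2⌋≤⌈n/2⌉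
        ; module ≤-Reasoning )
open import Data.Nat.Tactic.RingSolver using (solve-∀)
open import Data.Product using (Σ; _×_; _,_; proj₁; proj₂)
open import Data.Sum using (_⊎_; inj₁; inj₂)
open import Data.Unit using (tt)
open import Data.List using (List; []; _∷_; length; filter)
open import Data.List.Properties using (filter-none; filter-≐)
import Data.List.Membership.Setoid as Membership
open import Data.List.Membership.Setoid.Properties using (∈-resp-≈; ∈-filter⁻)
open import Data.List.Relation.Unary.All as All using (All; []; _∷_)
open import Data.List.Relation.Unary.AllPairs as AllPairs using (AllPairs; []; _∷_)
open import Data.List.Relation.Unary.Any using (here; there)
open import Data.List.Relation.Unary.Unique.Setoid using (Unique)
open import Data.List.Relation.Unary.Unique.Setoid.Properties using (filter⁺)
open import Data.List.Relation.Unary.Sorted.TotalOrder.Properties using (Sorted⇒AllPairs)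
open import Data.List.Relation.Binary.Permutation.Propositional using (_↭_; refl; prep; swap; trans; ↭-sym; ↭⇒↭ₛ′)
import Data.List.Relation.Binary.Permutation.Propositional.Properties as Perm
import Data.List.Relation.Binary.Permutation.Setoid.Properties as PermS
import Data.List.Sort.InsertionSort.Base as InsertionSort
import Data.List.Sort.InsertionSort.Properties as InsertionSortProperties
open import Relation.Nullary using (Dec; yes; no; does; ¬_; ¬?; contradiction)
open import Relation.Unary using (Decidable; _≐_)
open import Relation.Unary.Properties using (_∩?_)
open import Relation.Binary using (tri<; tri≈; tri>)
open import Relation.Binary.Bundles using (StrictTotalOrder; DecTotalOrder)
import Relation.Binary.Construct.StrictToNonStrict as StrictToNonStrict
import Relation.Binary.Properties.StrictTotalOrder as STO
open import Relation.Binary.PropositionalEquality as ≡ using (_≡_; refl; cong; cong₂; module ≡-Reasoning)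
open import Algebra.Properties.CommutativeSemigroup +-commutativeSemigroup using (interchange; x∙yz≈y∙xz)
open import Defs using (module RepeatedStep; select)

𝟙 : {P : Set} → Dec P → ℕ
𝟙 d = if does d then 1 else 0

𝟙-yes : {P : Set} (d : Dec P) → P → 𝟙 d ≡ 1
𝟙-yes (yes _) _ = refl
𝟙-yes (no ¬p) p = contradiction p ¬p

𝟙-no : {P : Set} (d : Dec P) → ¬ P → 𝟙 d ≡ 0
𝟙-no (yes p) ¬p = contradiction p ¬p
𝟙-no (no _)  _  = refl

module Counting {A : Set} where
  open ≡-Reasoning

  count : {P : A → Set} → Decidable P → List A → ℕ
  count P? xs = length (filter P? xs)

  count-∷ : {P : A → Set} (P? : Decidable P) (x : A) (xs : List A) →
            count P? (x ∷ xs) ≡ 𝟙 (P? x) + count P? xs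
  count-∷ P? x xs with does (P? x)
  ... | true  = refl
  ... | false = refl

  count-+ : {P Q R : A → Set} (P? : Decidable P) (Q? : Decidable Q) (R? : Decidable R) →
            (∀ x → 𝟙 (P? x) + 𝟙 (Q? x) ≡ 𝟙 (R? x)) →
            ∀ xs → count P? xs + count Q? xs ≡ count R? xs
  count-+ P? Q? R? pointwise [] = refl
  count-+ P? Q? R? pointwise (x ∷ xs) = begin
    count P? (x ∷ xs) + count Q? (x ∷ xs)
      ≡⟨ cong₂ _+_ (count-∷ P? x xs) (count-∷ Q? x xs) ⟩
    (𝟙 (P? x) + count P? xs) + (𝟙 (Q? x) + count Q? xs)
      ≡⟨ interchange (𝟙 (P? x)) (count P? xs) (𝟙 (Q? x)) (count Q? xs) ⟩
    (𝟙 (P? x) + 𝟙 (Q? x)) + (count P? xs + count Q? xs)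
      ≡⟨ cong₂ _+_ (pointwise x) (count-+ P? Q? R? pointwise xs) ⟩
    𝟙 (R? x) + count R? xs
      ≡⟨ count-∷ R? x xs ⟨
    count R? (x ∷ xs) ∎

  count-partition : {P Q : A → Set} (P? : Decidable P) (Q? : Decidable Q) →
                    (∀ x → 𝟙 (P? x) + 𝟙 (Q? x) ≡ 1) →
                    ∀ xs → count P? xs + count Q? xs ≡ length xs
  count-partition P? Q? exactly-one xs =
    ≡.trans (count-+ P? Q? (λ _ → yes tt) exactly-one xs) (count-everything xs)
    where
    count-everything : ∀ xs → count (λ _ → yes tt) xs ≡ length xs
    count-everything []       = refl
    count-everything (x ∷ xs) = cong suc (count-everything xs)

  count-none : {P : A → Set} (P? : Decidable P) {xs : List A} → All (λ x → ¬ P x) xs → count P? xs ≡ 0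
  count-none P? none = cong length (filter-none P? none)

  count-filter : {P Q : A → Set} (P? : Decidable P) (Q? : Decidable Q) →
                 ∀ xs → count P? (filter Q? xs) ≡ count (Q? ∩? P?) xs
  count-filter P? Q? [] = refl
  count-filter P? Q? (x ∷ xs) with does (Q? x)
  ... | false = count-filter P? Q? xs
  ... | true  with does (P? x)
  ...   | true  = cong suc (count-filter P? Q? xs)
  ...   | false = count-filter P? Q? xs

  count-↭ : {P : A → Set} (P? : Decidable P) {xs ys : List A} → xs ↭ ys → count P? xs ≡ count P? ys
  count-↭ P? refl = refl
  count-↭ P? {x ∷ xs} {.x ∷ ys} (prep x p) = begin
    count P? (x ∷ xs)         ≡⟨ count-∷ P? x xs ⟩
    𝟙 (P? x) + count P? xs    ≡⟨ cong (𝟙 (P? x) +_) (count-↭ P? p) ⟩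
    𝟙 (P? x) + count P? ys    ≡⟨ count-∷ P? x ys ⟨
    count P? (x ∷ ys)         ∎
  count-↭ P? {x ∷ y ∷ xs} {.y ∷ .x ∷ ys} (swap x y p) = begin
    count P? (x ∷ y ∷ xs)                ≡⟨ ≡.trans (count-∷ P? x _) (cong (𝟙 (P? x) +_) (count-∷ P? y xs)) ⟩
    𝟙 (P? x) + (𝟙 (P? y) + count P? xs)  ≡⟨ cong (λ c → 𝟙 (P? x) + (𝟙 (P? y) + c)) (count-↭ P? p) ⟩
    𝟙 (P? x) + (𝟙 (P? y) + count P? ys)  ≡⟨ x∙yz≈y∙xz (𝟙 (P? x)) (𝟙 (P? y)) (count P? ys) ⟩
    𝟙 (P? y) + (𝟙 (P? x) + count P? ys)  ≡⟨ ≡.trans (count-∷ P? y _) (cong (𝟙 (P? y) +_) (count-∷ P? x ys)) ⟨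
    count P? (y ∷ x ∷ ys)                ∎
  count-↭ P? (trans p q) = ≡.trans (count-↭ P? p) (count-↭ P? q)

module Arithmetic where
  open ≤-Reasoning

  n≤2⌈n/2⌉ : ∀ n → n ≤ 2 * ⌈ n /2⌉
  n≤2⌈n/2⌉ n = begin
    n                       ≡⟨ ⌊n/2⌋+⌈n/2⌉≡n n ⟨
    ⌊ n /2⌋ + ⌈ n /2⌉       ≤⟨ +-monoˡ-≤ ⌈ n /2⌉ (⌊n/2⌋≤⌈n/2⌉ n) ⟩
    ⌈ n /2⌉ + ⌈ n /2⌉       ≡⟨ cong (⌈ n /2⌉ +_) (+-comm 0 ⌈ n /2⌉) ⟩
    2 * ⌈ n /2⌉             ∎

  2⌈n/2⌉≤1+n : ∀ n → 2 * ⌈ n /2⌉ ≤ suc n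
  2⌈n/2⌉≤1+n zero          = z≤n
  2⌈n/2⌉≤1+n (suc zero)    = s≤s (s≤s z≤n)
  2⌈n/2⌉≤1+n (suc (suc n)) = begin
    2 * suc ⌈ n /2⌉         ≡⟨ *-suc 2 ⌈ n /2⌉ ⟩
    2 + 2 * ⌈ n /2⌉         ≤⟨ +-monoʳ-≤ 2 (2⌈n/2⌉≤1+n n) ⟩
    suc (suc (suc n))       ∎

  -- If fewer than half (namely ⌈k/2⌉ - 1) of k elements lie below the
  -- median, the u elements not below it form at least half.
  upper-half : ∀ {k c u} → c + 1 ≡ ⌈ k /2⌉ → c + u ≡ k → k ≤ 2 * u
  upper-half {k} {c} {u} rank total = begin
    k        ≡⟨ total ⟨
    c + u    ≤⟨ +-monoˡ-≤ u c≤u ⟩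
    u + u    ≡⟨ cong (u +_) (+-comm 0 u) ⟩
    2 * u    ∎
    where
    doubled : c + suc (suc c) ≤ c + suc u
    doubled = begin
      c + suc (suc c) ≡⟨ twice c ⟩
      2 * (c + 1)     ≡⟨ cong (2 *_) rank ⟩
      2 * ⌈ k /2⌉     ≤⟨ 2⌈n/2⌉≤1+n k ⟩
      suc k           ≡⟨ cong suc total ⟨
      suc (c + u)     ≡⟨ +-suc c u ⟨
      c + suc u       ∎
      where
      twice : ∀ c → c + suc (suc c) ≡ 2 * (c + 1)
      twice = solve-∀
    c≤u : c ≤ u
    c≤u = <⇒≤ (≤-pred (+-cancelˡ-≤ c _ _ doubled))

  -- Two rounds of "a median lies in a group at least half of which lies on
  -- its side": if u of the k second-level medians lie on one side, then at
  -- least 4u - 3 of the n elements do, leaving at most n + 3 - 2k elements s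
  -- on the other side.
  two-level-bound : ∀ {k u v w s n} → k ≤ 2 * u → 2 * u ≤ v + 1 → 2 * v ≤ w + 1 →
                    s + w ≡ n → s + 2 * k ≤ n + 3
  two-level-bound {k} {u} {v} {w} {s} {n} k≤2u 2u≤v+1 2v≤w+1 split = begin
    s + 2 * k          ≤⟨ +-monoʳ-≤ s (*-monoʳ-≤ 2 k≤2u) ⟩
    s + 2 * (2 * u)    ≤⟨ +-monoʳ-≤ s (*-monoʳ-≤ 2 2u≤v+1) ⟩
    s + 2 * (v + 1)    ≡⟨ cong (s +_) (double-suc v) ⟩
    s + (2 * v + 2)    ≤⟨ +-monoʳ-≤ s (+-monoˡ-≤ 2 2v≤w+1) ⟩
    s + (w + 1 + 2)    ≡⟨ regroup s w ⟩
    s + w + 3          ≡⟨ cong (_+ 3) split ⟩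
    n + 3              ∎
    where
    double-suc : ∀ v → 2 * (v + 1) ≡ 2 * v + 2
    double-suc = solve-∀
    regroup : ∀ s w → s + (w + 1 + 2) ≡ s + w + 3
    regroup = solve-∀

  -- Total cost of a round: at most n comparisons for each level of medians,
  -- k₃ ≤ 108k for the recursive median selection (and k₃ ≤ 3 when k ≤ 3),
  -- n for the partition and t ≤ 108s for the recursion on a side of size s.
  round-cost : ∀ {n k s k₁ k₂ k₃ t} → n ≤ 9 * k → s + 2 * k ≤ n + 3 → s < n →
               k₁ ≤ n → k₂ ≤ n → k₃ ≤ 108 * k → (k ≤ 3 → k₃ ≤ 3) → t ≤ 108 * s →
               k₁ + k₂ + k₃ + n + t ≤ 108 * n
  round-cost {n} {k} {s} {k₁} {k₂} {k₃} {t} n≤9k balanced s<n k₁≤n k₂≤n k₃≤108k k₃-small t≤108s =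
    by-size (k ≤? 3)
    where
    linear-terms : ∀ {b} → k₃ ≤ b → k₁ + k₂ + k₃ + n + t ≤ n + n + b + n + 108 * s
    linear-terms k₃≤b = +-mono-≤ (+-mono-≤ (+-mono-≤ (+-mono-≤ k₁≤n k₂≤n) k₃≤b) ≤-refl) t≤108s

    by-size : Dec (k ≤ 3) → k₁ + k₂ + k₃ + n + t ≤ 108 * n
    by-size (yes k≤3) = +-cancelʳ-≤ 108 _ _ (begin
      k₁ + k₂ + k₃ + n + t + 108        ≤⟨ +-monoˡ-≤ 108 (linear-terms (k₃-small k≤3)) ⟩
      n + n + 3 + n + 108 * s + 108     ≡⟨ regroup n s ⟩
      (3 * n + 3) + 108 * suc s         ≤⟨ +-mono-≤ small-n (*-monoʳ-≤ 108 s<n) ⟩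
      108 + 108 * n                     ≡⟨ +-comm 108 (108 * n) ⟩
      108 * n + 108                     ∎)
      where
      regroup : ∀ n s → n + n + 3 + n + 108 * s + 108 ≡ (3 * n + 3) + 108 * suc s
      regroup = solve-∀
      small-n : 3 * n + 3 ≤ 108
      small-n = ≤-trans (+-monoˡ-≤ 3 (*-monoʳ-≤ 3 (≤-trans n≤9k (*-monoʳ-≤ 9 k≤3)))) (m≤m+n 84 24)
    by-size (no k≰3) = +-cancelʳ-≤ (108 * k) _ _ (begin
      k₁ + k₂ + k₃ + n + t + 108 * k              ≤⟨ +-monoˡ-≤ (108 * k) (linear-terms k₃≤108k) ⟩
      n + n + 108 * k + n + 108 * s + 108 * k     ≡⟨ regroup n k s ⟩
      3 * n + 108 * (s + 2 * k)                   ≤⟨ +-monoʳ-≤ (3 * n) (*-monoʳ-≤ 108 balanced) ⟩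
      3 * n + 108 * (n + 3)                       ≡⟨ expand n ⟩
      3 * n + 324 + 108 * n                       ≤⟨ +-monoˡ-≤ (108 * n) (+-mono-≤ (*-monoʳ-≤ 3 n≤9k)
                                                                                   (*-monoʳ-≤ 81 (≰⇒> k≰3))) ⟩
      3 * (9 * k) + 81 * k + 108 * n              ≡⟨ collect n k ⟩
      108 * n + 108 * k                           ∎)
      where
      regroup : ∀ n k s → n + n + 108 * k + n + 108 * s + 108 * k ≡ 3 * n + 108 * (s + 2 * k)
      regroup = solve-∀
      expand : ∀ n → 3 * n + 108 * (n + 3) ≡ 3 * n + 324 + 108 * n
      expand = solve-∀
      collect : ∀ n k → 3 * (9 * k) + 81 * k + 108 * n ≡ 108 * n + 108 * k
      collect = solve-∀

  lower-index : ∀ {i a} → 1 ≤ i → i ∸ 1 < a → i ≤ a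
  lower-index {suc i} _ i<a = i<a

  upper-index : ∀ a i b → a < i ∸ 1 → i ≤ a + 1 + b →
                1 ≤ i ∸ a ∸ 1 × i ∸ a ∸ 1 ≤ b × a + 1 + (i ∸ a ∸ 1 ∸ 1) ≡ i ∸ 1
  upper-index zero    (suc (suc i)) b _        (s≤s i≤b) = s≤s z≤n , i≤b , refl
  upper-index (suc a) (suc (suc i)) b (s≤s lt) (s≤s le) with upper-index a (suc i) b lt le
  ... | positive , bounded , shifted = positive , bounded , cong suc shifted

module Analysis (O : StrictTotalOrder 0ℓ 0ℓ 0ℓ) where
  open StrictTotalOrder O renaming (Carrier to C; _<_ to _≺_; trans to ≺-trans)
  open RepeatedStep O hiding (select)
  -- The non-strict order x ≼ y, i.e. x ≺ y ⊎ x ≈ y, decided by compare x y.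
  open DecTotalOrder (STO.decTotalOrder O) using () renaming (_≤_ to _≼_; _≤?_ to _≼?_; trans to ≼-trans)
  open Membership Eq.setoid using (_∈_)
  open StrictToNonStrict _≈_ _≺_ using (≤-<-trans)

  open Counting {A = C}
  open Arithmetic

  module Sort where
    open InsertionSort (STO.decTotalOrder O) public
    open InsertionSortProperties (STO.decTotalOrder O) public

  -- "x lies above m", decided by comparing x with m as the partition step does.
  _≻?_ : (x m : C) → Dec (m ≺ x)
  x ≻? m with compare x m
  ... | tri< x≺m _ _ = no (asym x≺m)
  ... | tri≈ _ x≈m _ = no (irrefl (Eq.sym x≈m))
  ... | tri> _ _ m≺x = yes m≺x

  data TwoOf (P : C → Set) (a b c : C) : Set where
    ab : P a → P b → TwoOf P a b c
    ac : P a → P c → TwoOf P a b c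
    bc : P b → P c → TwoOf P a b c

  TwoOf-map : ∀ {P Q a b c} → (∀ {x} → P x → Q x) → TwoOf P a b c → TwoOf Q a b c
  TwoOf-map f (ab pa pb) = ab (f pa) (f pb)
  TwoOf-map f (ac pa pc) = ac (f pa) (f pc)
  TwoOf-map f (bc pb pc) = bc (f pb) (f pc)

  OneOf : C → C → C → C → Set
  OneOf m a b c = m ≡ a ⊎ m ≡ b ⊎ m ≡ c

  one-of-three : ∀ {P : C → Set} {m a b c} → OneOf m a b c → P a → P b → P c → P m
  one-of-three (inj₁ refl)        pa _  _  = pa
  one-of-three (inj₂ (inj₁ refl)) _  pb _  = pb
  one-of-three (inj₂ (inj₂ refl)) _  _  pc = pc

  record IsMedian (m a b c : C) : Set where
    field
      one-of  : OneOf m a b c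
      below-two : TwoOf (m ≼_) a b c
      above-two : TwoOf (_≼ m) a b c

  IsMedian-swap : ∀ {m a b c} → IsMedian m b a c → IsMedian m a b c
  IsMedian-swap med = record
    { one-of    = swap-one (IsMedian.one-of med)
    ; below-two = swap-two (IsMedian.below-two med)
    ; above-two = swap-two (IsMedian.above-two med)
    }
    where
    swap-one : ∀ {m a b c} → OneOf m b a c → OneOf m a b c
    swap-one (inj₁ e)        = inj₂ (inj₁ e)
    swap-one (inj₂ (inj₁ e)) = inj₁ e
    swap-one (inj₂ (inj₂ e)) = inj₂ (inj₂ e)
    swap-two : ∀ {P a b c} → TwoOf P b a c → TwoOf P a b c
    swap-two (ab pb pa) = ab pa pb
    swap-two (ac pb pc) = bc pb pc
    swap-two (bc pa pc) = ac pa pc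

  ≼-refl : ∀ {x} → x ≼ x
  ≼-refl = inj₂ Eq.refl

  hi-median : ∀ {lo hi c} → lo ≼ hi → hi ≼ c → IsMedian hi lo hi c
  hi-median lo≼hi hi≼c = record { one-of = inj₂ (inj₁ refl) ; below-two = bc ≼-refl hi≼c ; above-two = ab lo≼hi ≼-refl }

  c-median : ∀ {lo hi c} → lo ≼ c → c ≼ hi → IsMedian c lo hi c
  c-median lo≼c c≼hi = record { one-of = inj₂ (inj₂ refl) ; below-two = bc c≼hi ≼-refl ; above-two = ac lo≼c ≼-refl }

  lo-median : ∀ {lo hi c} → lo ≼ hi → c ≼ lo → IsMedian lo lo hi c
  lo-median lo≼hi c≼lo = record { one-of = inj₁ refl ; below-two = ab ≼-refl lo≼hi ; above-two = ac ≼-refl c≼lo }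

  medianSorted-spec : ∀ lo hi c → lo ≼ hi →
    IsMedian (proj₁ (medianSorted lo hi c)) lo hi c × proj₂ (medianSorted lo hi c) ≤ 2
  medianSorted-spec lo hi c lo≼hi with compare hi c
  ... | tri< hi≺c _ _ = hi-median lo≼hi (inj₁ hi≺c) , s≤s z≤n
  ... | tri≈ _ hi≈c _ = hi-median lo≼hi (inj₂ hi≈c) , s≤s z≤n
  ... | tri> _ _ c≺hi with compare lo c
  ...   | tri< lo≺c _ _ = c-median (inj₁ lo≺c) (inj₁ c≺hi) , s≤s (s≤s z≤n)
  ...   | tri≈ _ lo≈c _ = c-median (inj₂ lo≈c) (inj₁ c≺hi) , s≤s (s≤s z≤n)
  ...   | tri> _ _ c≺lo = lo-median lo≼hi (inj₁ c≺lo) , s≤s (s≤s z≤n)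

  median3-spec : ∀ a b c → IsMedian (proj₁ (median3 a b c)) a b c × proj₂ (median3 a b c) ≤ 3
  median3-spec a b c with compare a b
  ... | tri< a≺b _ _ with medianSorted a b c | medianSorted-spec a b c (inj₁ a≺b)
  ...   | _ | med , k≤2 = med , s≤s k≤2
  median3-spec a b c | tri≈ _ a≈b _ with medianSorted b a c | medianSorted-spec b a c (inj₂ (Eq.sym a≈b))
  ...   | _ | med , k≤2 = IsMedian-swap med , s≤s k≤2
  median3-spec a b c | tri> _ _ b≺a with medianSorted b a c | medianSorted-spec b a c (inj₁ b≺a)
  ...   | _ | med , k≤2 = IsMedian-swap med , s≤s k≤2

  median2-spec : ∀ a b → (proj₁ (median2 a b) ≡ a ⊎ proj₁ (median2 a b) ≡ b) × proj₂ (median2 a b) ≤ 2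
  median2-spec a b with compare a b
  ... | tri< _ _ _ = inj₁ refl , s≤s z≤n
  ... | tri≈ _ _ _ = inj₁ refl , s≤s z≤n
  ... | tri> _ _ _ = inj₂ refl , s≤s z≤n

  data Medians : List C → List C → ℕ → Set where
    none   : Medians [] [] 0
    single : ∀ a → Medians (a ∷ []) (a ∷ []) 0
    pair   : ∀ {a b m k} → m ≡ a ⊎ m ≡ b → k ≤ 2 → Medians (a ∷ b ∷ []) (m ∷ []) k
    triple : ∀ {a b c rest m k ms k′} → IsMedian m a b c → k ≤ 3 → Medians rest ms k′ →
             Medians (a ∷ b ∷ c ∷ rest) (m ∷ ms) (k + k′)

  medians-spec : ∀ L → Medians L (proj₁ (medians L)) (proj₂ (medians L))
  medians-spec (a ∷ b ∷ c ∷ rest) with median3 a b c | median3-spec a b c | medians rest | medians-spec rest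
  ... | _ | med , k≤3 | _ | rest-spec = triple med k≤3 rest-spec
  medians-spec (a ∷ b ∷ []) with median2 a b | median2-spec a b
  ... | _ | one-of , k≤2 = pair one-of k≤2
  medians-spec (a ∷ []) = single a
  medians-spec []       = none

  medians-cost : ∀ {L M k} → Medians L M k → k ≤ length L
  medians-cost none                  = z≤n
  medians-cost (single a)            = z≤n
  medians-cost (pair _ k≤2)          = k≤2
  medians-cost (triple _ k≤3 rest)   = +-mono-≤ k≤3 (medians-cost rest)

  medians-shorter : ∀ {L M k} → Medians L M k → length M ≤ length L
  medians-shorter none              = z≤n
  medians-shorter (single a)        = s≤s z≤n
  medians-shorter (pair _ _)        = s≤s z≤n
  medians-shorter (triple _ _ rest) = s≤s (m≤n⇒m≤1+n (m≤n⇒m≤1+n (medians-shorter rest)))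

  medians-cover : ∀ {L M k} → Medians L M k → length L ≤ 3 * length M
  medians-cover none       = z≤n
  medians-cover (single a) = s≤s z≤n
  medians-cover (pair _ _) = s≤s (s≤s z≤n)
  medians-cover (triple {rest = rest} {ms = ms} _ _ R) = begin
    3 + length rest    ≤⟨ +-monoʳ-≤ 3 (medians-cover R) ⟩
    3 + 3 * length ms  ≡⟨ *-suc 3 (length ms) ⟨
    3 * suc (length ms) ∎
    where open ≤-Reasoning

  medians-nonempty : ∀ {L M k} → Medians L M k → 1 ≤ length L → 1 ≤ length M
  medians-nonempty (single _)     _ = s≤s z≤n
  medians-nonempty (pair _ _)     _ = s≤s z≤n
  medians-nonempty (triple _ _ _) _ = s≤s z≤n

  medians-shrink : ∀ {L M k} → Medians L M k → 2 ≤ length L → length M < length L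
  medians-shrink (single a)        (s≤s ())
  medians-shrink (pair _ _)        _ = s≤s (s≤s z≤n)
  medians-shrink (triple _ _ rest) _ = s≤s (s≤s (m≤n⇒m≤1+n (medians-shorter rest)))

  medians-all : ∀ {P : C → Set} {L M k} → Medians L M k → All P L → All P M
  medians-all none                  _                       = []
  medians-all (single a)            pL                      = pL
  medians-all (pair (inj₁ refl) _)  (pa ∷ _ ∷ [])           = pa ∷ []
  medians-all (pair (inj₂ refl) _)  (_ ∷ pb ∷ [])           = pb ∷ []
  medians-all (triple med _ rest)   (pa ∷ pb ∷ pc ∷ prest)  =
    one-of-three (IsMedian.one-of med) pa pb pc ∷ medians-all rest prest

  medians-⊆ : ∀ {L M k x} → Medians L M k → x ∈ M → x ∈ L
  medians-⊆ R = All.lookupₛ Eq.setoid (∈-resp-≈ Eq.setoid)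
                      (medians-all R (All.tabulateₛ Eq.setoid (λ x∈L → x∈L)))

  medians-unique : ∀ {L M k} → Medians L M k → Unique Eq.setoid L → Unique Eq.setoid M
  medians-unique none       _ = []
  medians-unique (single a) u = u
  medians-unique (pair _ _) _ = [] ∷ []
  medians-unique (triple med _ rest) ((_ ∷ _ ∷ a≉rest) ∷ (_ ∷ b≉rest) ∷ c≉rest ∷ u) =
    medians-all rest (one-of-three (IsMedian.one-of med) a≉rest b≉rest c≉rest) ∷ medians-unique rest u

  -- Suppose that whenever P holds at the median of a
  -- group it holds for at least two members of that group.  Then each group
  -- whose median satisfies P contributes at least two elements satisfying P,
  -- so twice the number of such medians is at most one more than the number
  -- of elements of L satisfying P (the extra one for a final short group).
  module _ {P : C → Set} (P? : Decidable P)
           (majority : ∀ {m a b c} → IsMedian m a b c → P m → TwoOf P a b c) where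

    two-of-𝟙 : ∀ {a b c} → TwoOf P a b c → 2 ≤ 𝟙 (P? a) + 𝟙 (P? b) + 𝟙 (P? c)
    two-of-𝟙 {a} {b} {c} (ab pa pb) rewrite 𝟙-yes (P? a) pa | 𝟙-yes (P? b) pb = s≤s (s≤s z≤n)
    two-of-𝟙 {a} {b} {c} (ac pa pc) rewrite 𝟙-yes (P? a) pa | 𝟙-yes (P? c) pc = s≤s (m≤n+m 1 (𝟙 (P? b)))
    two-of-𝟙 {a} {b} {c} (bc pb pc) rewrite 𝟙-yes (P? b) pb | 𝟙-yes (P? c) pc = +-monoˡ-≤ 1 (m≤n+m 1 (𝟙 (P? a)))

    median-𝟙 : ∀ {m a b c} → IsMedian m a b c → 2 * 𝟙 (P? m) ≤ 𝟙 (P? a) + 𝟙 (P? b) + 𝟙 (P? c)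
    median-𝟙 {m} med with P? m
    ... | yes pm = two-of-𝟙 (majority med pm)
    ... | no _   = z≤n

    medians-majority : ∀ {L M k} → Medians L M k → 2 * count P? M ≤ count P? L + 1
    medians-majority none = z≤n
    medians-majority (single a) with P? a
    ... | yes _ = ≤-refl
    ... | no _  = z≤n
    medians-majority (pair {a} {b} (inj₁ refl) _) with P? a
    ... | no _  = z≤n
    ... | yes _ with P? b
    ...   | yes _ = s≤s (s≤s z≤n)
    ...   | no _  = ≤-refl
    medians-majority (pair {a} {b} (inj₂ refl) _) with P? a
    ... | yes _ with P? b
    ...   | yes _ = s≤s (s≤s z≤n)
    ...   | no _  = z≤n
    medians-majority (pair {a} {b} (inj₂ refl) _) | no _ with P? b
    ...   | yes _ = ≤-refl
    ...   | no _  = z≤n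
    medians-majority (triple {a} {b} {c} {rest} {m} {_} {ms} med _ R) = begin
      2 * count P? (m ∷ ms)                                   ≡⟨ cong (2 *_) (count-∷ P? m ms) ⟩
      2 * (𝟙 (P? m) + count P? ms)                            ≡⟨ *-distribˡ-+ 2 (𝟙 (P? m)) (count P? ms) ⟩
      2 * 𝟙 (P? m) + 2 * count P? ms                          ≤⟨ +-mono-≤ (median-𝟙 med) (medians-majority R) ⟩
      𝟙 (P? a) + 𝟙 (P? b) + 𝟙 (P? c) + (count P? rest + 1)   ≡⟨ regroup (𝟙 (P? a)) (𝟙 (P? b)) _ _ ⟩
      𝟙 (P? a) + (𝟙 (P? b) + (𝟙 (P? c) + count P? rest)) + 1 ≡⟨ cong (_+ 1) expand ⟨
      count P? (a ∷ b ∷ c ∷ rest) + 1                          ∎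
      where
      open ≤-Reasoning
      regroup : ∀ x y z w → x + y + z + (w + 1) ≡ x + (y + (z + w)) + 1
      regroup = solve-∀
      expand : count P? (a ∷ b ∷ c ∷ rest) ≡ 𝟙 (P? a) + (𝟙 (P? b) + (𝟙 (P? c) + count P? rest))
      expand = ≡.trans (count-∷ P? a _) (cong (𝟙 (P? a) +_)
                 (≡.trans (count-∷ P? b _) (cong (𝟙 (P? b) +_) (count-∷ P? c rest))))

  upward-majority : ∀ {P : C → Set} → (∀ {x y} → x ≼ y → P x → P y) →
                    ∀ {m a b c} → IsMedian m a b c → P m → TwoOf P a b c
  upward-majority up med pm = TwoOf-map (λ m≼x → up m≼x pm) (IsMedian.below-two med)

  downward-majority : ∀ {P : C → Set} → (∀ {x y} → x ≼ y → P y → P x) →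
                      ∀ {m a b c} → IsMedian m a b c → P m → TwoOf P a b c
  downward-majority down med pm = TwoOf-map (λ x≼m → down x≼m pm) (IsMedian.above-two med)

  insert-agrees : ∀ x ys → proj₁ (insert x ys) ≡ Sort.insert x ys
  insert-agrees x []       = refl
  insert-agrees x (y ∷ ys) with compare x y
  ... | tri< _ _ _ = refl
  ... | tri≈ _ _ _ = refl
  ... | tri> _ _ _ with insert x ys | insert-agrees x ys
  ...   | (zs , k) | zs≡ = cong (y ∷_) zs≡

  isort-agrees : ∀ xs → proj₁ (isort xs) ≡ Sort.sort xs
  isort-agrees []       = refl
  isort-agrees (x ∷ xs) with isort xs | isort-agrees xs
  ... | (ys , k) | refl with insert x ys | insert-agrees x ys
  ...   | (zs , k′) | zs≡ = zs≡

  pairs : ℕ → ℕ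
  pairs zero    = 0
  pairs (suc n) = pairs n + n

  insert-cost : ∀ x ys → proj₂ (insert x ys) ≤ length ys
  insert-cost x []       = z≤n
  insert-cost x (y ∷ ys) with compare x y
  ... | tri< _ _ _ = s≤s z≤n
  ... | tri≈ _ _ _ = s≤s z≤n
  ... | tri> _ _ _ with insert x ys | insert-cost x ys
  ...   | (zs , k) | k≤ = s≤s k≤

  isort-cost : ∀ xs → proj₂ (isort xs) ≤ pairs (length xs)
  isort-cost []       = z≤n
  isort-cost (x ∷ xs) with isort xs | isort-cost xs | isort-agrees xs
  ... | (ys , k) | k≤ | refl with insert x ys | insert-cost x ys
  ...   | (zs , k′) | k′≤ = +-mono-≤ k≤ (≤-trans k′≤ (≤-reflexive (Perm.↭-length (Sort.sort-↭ xs))))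

  pairs-small : ∀ {n} → n ≤ 3 → pairs n ≤ 3
  pairs-small {0}               _ = z≤n
  pairs-small {1}               _ = z≤n
  pairs-small {2}               _ = s≤s z≤n
  pairs-small {3}               _ = ≤-refl
  pairs-small {suc (suc (suc (suc _)))} (s≤s (s≤s (s≤s ())))

  sort-strict : ∀ xs → Unique Eq.setoid xs → AllPairs _≺_ (Sort.sort xs)
  sort-strict xs u = AllPairs.zipWith strict (sorted , distinct)
    where
    sorted : AllPairs _≼_ (Sort.sort xs)
    sorted = Sorted⇒AllPairs (DecTotalOrder.totalOrder (STO.decTotalOrder O)) (Sort.sort-↗ xs)
    distinct : Unique Eq.setoid (Sort.sort xs)
    distinct = PermS.Unique-resp-↭ Eq.setoid (↭⇒↭ₛ′ Eq.isEquivalence (↭-sym (Sort.sort-↭ xs))) u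
    strict : ∀ {x y} → x ≼ y × ¬ x ≈ y → x ≺ y
    strict (inj₁ x≺y , _)   = x≺y
    strict (inj₂ x≈y , x≉y) = contradiction x≈y x≉y

  nth-sorted : ∀ {ys} → AllPairs _≺_ ys → ∀ {i} → 1 ≤ i → i ≤ length ys →
               Σ C λ r → nth ys i ≡ just r × r ∈ ys × count (_<? r) ys ≡ i ∸ 1
  nth-sorted {y ∷ ys} (y≺ys ∷ _) {suc zero} _ _ = y , refl , here Eq.refl , (begin
    count (_<? y) (y ∷ ys)          ≡⟨ count-∷ (_<? y) y ys ⟩
    𝟙 (y <? y) + count (_<? y) ys   ≡⟨ cong₂ _+_ (𝟙-no (y <? y) (irrefl Eq.refl)) (count-none (_<? y) none-below) ⟩
    0                               ∎)
    where
    open ≡-Reasoning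
    none-below : All (λ z → ¬ z ≺ y) ys
    none-below = All.map (λ y≺z z≺y → asym y≺z z≺y) y≺ys
  nth-sorted {y ∷ ys} (y≺ys ∷ sorted) {suc (suc i)} _ (s≤s i<n) with nth-sorted sorted (s≤s z≤n) i<n
  ... | r , nth≡ , r∈ys , rank = r , nth≡ , there r∈ys , (begin
    count (_<? r) (y ∷ ys)          ≡⟨ count-∷ (_<? r) y ys ⟩
    𝟙 (y <? r) + count (_<? r) ys   ≡⟨ cong₂ _+_ (𝟙-yes (y <? r) y≺r) rank ⟩
    suc i                           ∎)
    where
    open ≡-Reasoning
    y≺r : y ≺ r
    y≺r = All.lookupₛ Eq.setoid (λ z≈w y≺z → <-respʳ-≈ z≈w y≺z) y≺ys r∈ys

  -- A run of the algorithm on (xs, i) returned the i-th smallest element of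
  -- xs using t comparisons, where t is at most linear in n = |xs|, at most 3
  -- when n ≤ 3, and at least n when n ≥ 4 (a partition step was performed).
  data Correct (xs : List C) (i : ℕ) : Maybe (C × ℕ) → Set where
    correct : ∀ {r t} → r ∈ xs → count (_<? r) xs ≡ i ∸ 1 →
              t ≤ 108 * length xs → (length xs ≤ 3 → t ≤ 3) → (4 ≤ length xs → length xs ≤ t) →
              Correct xs i (just (r , t))

  select-small : ∀ f xs i → length xs ≤ 3 → Unique Eq.setoid xs → 1 ≤ i → i ≤ length xs →
                 Correct xs i (selectF (suc f) xs i)
  select-small f xs i n≤3 u 1≤i i≤n with length xs ≤ᵇ 3 | ≤⇒≤ᵇ n≤3
  ... | false | ()
  ... | true  | _ with isort xs | isort-agrees xs | isort-cost xs
  ...   | (ys , k) | refl | k≤pairs with nth (Sort.sort xs) i | nth-sorted (sort-strict xs u) 1≤i i≤|sorted|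
    where
    i≤|sorted| : i ≤ length (Sort.sort xs)
    i≤|sorted| = ≤-trans i≤n (≤-reflexive (≡.sym (Perm.↭-length (Sort.sort-↭ xs))))
  ...     | .(just r) | r , refl , r∈sorted , rank =
    correct (Perm.Any-resp-↭ (Sort.sort-↭ xs) r∈sorted)
            (≡.trans (≡.sym (count-↭ (_<? r) (Sort.sort-↭ xs))) rank)
            (≤-trans k≤3 (≤-trans (m≤m+n 3 105) (*-monoʳ-≤ 108 (≤-trans 1≤i i≤n))))
            (λ _ → k≤3)
            (λ 4≤n → contradiction (≤-trans 4≤n n≤3) λ { (s≤s (s≤s (s≤s ()))) })
    where
    k≤3 : k ≤ 3
    k≤3 = ≤-trans k≤pairs (pairs-small n≤3)

  below-or-not : ∀ m x → 𝟙 (x <? m) + 𝟙 (¬? (x <? m)) ≡ 1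
  below-or-not m x with compare x m
  ... | tri< _ _ _ = refl
  ... | tri≈ _ _ _ = refl
  ... | tri> _ _ _ = refl

  below-or-equal : ∀ m x → 𝟙 (x <? m) + 𝟙 (x ≟ m) ≡ 𝟙 (x ≼? m)
  below-or-equal m x with compare x m
  ... | tri< _ _ _ = refl
  ... | tri≈ _ _ _ = refl
  ... | tri> _ _ _ = refl

  at-most-or-above : ∀ m x → 𝟙 (x ≼? m) + 𝟙 (x ≻? m) ≡ 1
  at-most-or-above m x with compare x m
  ... | tri< _ _ _ = refl
  ... | tri≈ _ _ _ = refl
  ... | tri> _ _ _ = refl

  count-≈-unique : ∀ {m L} → Unique Eq.setoid L → m ∈ L → count (_≟ m) L ≡ 1
  count-≈-unique {m} {x ∷ xs} (x≉xs ∷ _) (here m≈x) = begin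
    count (_≟ m) (x ∷ xs)          ≡⟨ count-∷ (_≟ m) x xs ⟩
    𝟙 (x ≟ m) + count (_≟ m) xs    ≡⟨ cong₂ _+_ (𝟙-yes (x ≟ m) (Eq.sym m≈x)) (count-none (_≟ m) others) ⟩
    1                              ∎
    where
    open ≡-Reasoning
    others : All (λ y → ¬ y ≈ m) xs
    others = All.map (λ x≉y y≈m → x≉y (Eq.trans (Eq.sym m≈x) (Eq.sym y≈m))) x≉xs
  count-≈-unique {m} {x ∷ xs} (x≉xs ∷ u) (there m∈xs) = begin
    count (_≟ m) (x ∷ xs)          ≡⟨ count-∷ (_≟ m) x xs ⟩
    𝟙 (x ≟ m) + count (_≟ m) xs    ≡⟨ cong₂ _+_ (𝟙-no (x ≟ m) x≉m) (count-≈-unique u m∈xs) ⟩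
    1                              ∎
    where
    open ≡-Reasoning
    x≉m : ¬ x ≈ m
    x≉m = All.lookupₛ Eq.setoid (λ y≈z x≉y x≈z → x≉y (Eq.trans x≈z (Eq.sym y≈z))) x≉xs m∈xs

  at-most-unique : ∀ {m L} → Unique Eq.setoid L → m ∈ L → count (_≼? m) L ≡ count (_<? m) L + 1
  at-most-unique {m} {L} u m∈L =
    ≡.trans (≡.sym (count-+ (_<? m) (_≟ m) (_≼? m) (below-or-equal m) L))
            (cong (count (_<? m) L +_) (count-≈-unique u m∈L))

  -- A good pivot m for a round on xs, after `overhead` comparisons spent on
  -- choosing it: it splits xs into a = |{x ≺ m}|, m itself and b = |{x ≻ m}|,
  -- and the round stays within the linear budget whatever side it recurses on.
  record GoodPivot (xs : List C) (m : C) (overhead : ℕ) : Set where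
    field
      pivot∈  : m ∈ xs
      at-most : count (_≼? m) xs ≡ count (_<? m) xs + 1
      sizes   : count (_<? m) xs + 1 + count (_≻? m) xs ≡ length xs
      lower<  : count (_<? m) xs < length xs
      upper<  : count (_≻? m) xs < length xs
      budget  : ∀ {s t} → s ≤ count (_<? m) xs ⊎ s ≤ count (_≻? m) xs → t ≤ 108 * s →
                overhead + length xs + t ≤ 108 * length xs

  -- Let m be the median of the k medians of
  -- medians M′ of xs.  At least half of M′ lies on either side of m, hence
  -- (majority counting, twice) at least 2k - 3 elements of xs do, so each
  -- side of the partition around m has at most n + 3 - 2k elements.
  pivot-balanced : ∀ {xs M M′ k₁ k₂ m} → Unique Eq.setoid xs → Medians xs M k₁ → Medians M M′ k₂ →
                   m ∈ M′ → count (_<? m) M′ + 1 ≡ ⌈ length M′ /2⌉ →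
                   count (_<? m) xs + 2 * length M′ ≤ length xs + 3 × count (_≻? m) xs + 2 * length M′ ≤ length xs + 3
  pivot-balanced {xs} {M} {M′} {m = m} u R R′ m∈M′ rank = below-bound , above-bound
    where
    not-below : Decidable (λ x → ¬ x ≺ m)
    not-below x = ¬? (x <? m)

    not-below-up : ∀ {x y} → x ≼ y → ¬ x ≺ m → ¬ y ≺ m
    not-below-up x≼y x⊀m y≺m = x⊀m (≤-<-trans Eq.sym ≺-trans <-respˡ-≈ x≼y y≺m)

    at-most-down : ∀ {x y} → x ≼ y → y ≼ m → x ≼ m
    at-most-down = ≼-trans

    below-bound : count (_<? m) xs + 2 * length M′ ≤ length xs + 3
    below-bound = two-level-bound {u = count not-below M′} {count not-below M} {count not-below xs}
      (upper-half rank (count-partition (_<? m) not-below (below-or-not m) M′))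
      (medians-majority not-below (upward-majority not-below-up) R′)
      (medians-majority not-below (upward-majority not-below-up) R)
      (count-partition (_<? m) not-below (below-or-not m) xs)

    at-most-half : length M′ ≤ 2 * count (_≼? m) M′
    at-most-half = ≤-trans (n≤2⌈n/2⌉ (length M′)) (≤-reflexive (cong (2 *_) (≡.sym
                     (≡.trans (at-most-unique (medians-unique R′ (medians-unique R u)) m∈M′) rank))))

    above-bound : count (_≻? m) xs + 2 * length M′ ≤ length xs + 3
    above-bound = two-level-bound {u = count (_≼? m) M′} {count (_≼? m) M} {count (_≼? m) xs}
      at-most-half
      (medians-majority (_≼? m) (downward-majority at-most-down) R′)
      (medians-majority (_≼? m) (downward-majority at-most-down) R)
      (≡.trans (+-comm (count (_≻? m) xs) _) (count-partition (_≼? m) (_≻? m) (at-most-or-above m) xs))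

  balanced-is-good : ∀ {xs m k k₁ k₂ k₃} → Unique Eq.setoid xs → m ∈ xs → length xs ≤ 9 * k →
                     count (_<? m) xs + 2 * k ≤ length xs + 3 → count (_≻? m) xs + 2 * k ≤ length xs + 3 →
                     k₁ ≤ length xs → k₂ ≤ length xs → k₃ ≤ 108 * k → (k ≤ 3 → k₃ ≤ 3) →
                     GoodPivot xs m (k₁ + k₂ + k₃)
  balanced-is-good {xs} {m} {k} u m∈xs n≤9k below-bound above-bound k₁≤n k₂≤n k₃≤108k k₃-small = record
    { pivot∈  = m∈xs
    ; at-most = at-most-unique u m∈xs
    ; sizes   = sizes
    ; lower<  = lower<
    ; upper<  = upper<
    ; budget  = λ side t≤108s → round-cost n≤9k (proj₁ (sides side)) (proj₂ (sides side))
                                  k₁≤n k₂≤n k₃≤108k k₃-small t≤108s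
    }
    where
    n = length xs
    a = count (_<? m) xs
    b = count (_≻? m) xs

    sizes : a + 1 + b ≡ n
    sizes = ≡.trans (cong (_+ b) (≡.sym (at-most-unique u m∈xs)))
                    (count-partition (_≼? m) (_≻? m) (at-most-or-above m) xs)

    lower< : a < n
    lower< = ≤-trans (≤-trans (≤-reflexive (+-comm 1 a)) (m≤m+n (a + 1) b)) (≤-reflexive sizes)

    upper< : b < n
    upper< = ≤-trans (+-monoˡ-≤ b (m≤n+m 1 a)) (≤-reflexive sizes)

    sides : ∀ {s} → s ≤ a ⊎ s ≤ b → s + 2 * k ≤ n + 3 × s < n
    sides (inj₁ s≤a) = ≤-trans (+-monoˡ-≤ (2 * k) s≤a) below-bound , ≤-trans (s≤s s≤a) lower<
    sides (inj₂ s≤b) = ≤-trans (+-monoˡ-≤ (2 * k) s≤b) above-bound , ≤-trans (s≤s s≤b) upper<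

  pivot-is-good : ∀ {xs M M′ k₁ k₂ m k₃} → Unique Eq.setoid xs → 4 ≤ length xs →
                  Medians xs M k₁ → Medians M M′ k₂ → Correct M′ ⌈ length M′ /2⌉ (just (m , k₃)) →
                  GoodPivot xs m (k₁ + k₂ + k₃)
  pivot-is-good {xs} {M} {M′} u 4≤n R R′ (correct m∈M′ rank k₃-linear k₃-small _) =
    balanced-is-good u (medians-⊆ R (medians-⊆ R′ m∈M′)) n≤9k below above
      (medians-cost R) (≤-trans (medians-cost R′) (medians-shorter R)) k₃-linear k₃-small
    where
    n≤9k : length xs ≤ 9 * length M′
    n≤9k = ≤-trans (medians-cover R) (≤-trans (*-monoʳ-≤ 3 (medians-cover R′))
                                              (≤-reflexive (≡.sym (*-assoc 3 3 (length M′)))))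
    M′-nonempty : 1 ≤ length M′
    M′-nonempty = medians-nonempty R′ (medians-nonempty R (≤-trans (s≤s z≤n) 4≤n))
    balanced = pivot-balanced u R R′ m∈M′ (≡.trans (cong (_+ 1) rank) (m∸n+n≡m (⌈n/2⌉-mono M′-nonempty)))
    below = proj₁ balanced
    above = proj₂ balanced

  partition-spec : ∀ m xs → partition m xs ≡ (filter (_<? m) xs , filter (_≻? m) xs , length xs)
  partition-spec m [] = refl
  partition-spec m (x ∷ xs) with partition m xs | partition-spec m xs
  ... | _ | refl with compare x m
  ... | tri< _ _ _ = refl
  ... | tri≈ _ _ _ = refl
  ... | tri> _ _ _ = refl

  pivot-answer : ∀ {xs m c i} → GoodPivot xs m c → 4 ≤ length xs → count (_<? m) xs ≡ i ∸ 1 →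
                 Correct xs i (just (m , c + length xs))
  pivot-answer {xs} {c = c} good 4≤n rank = correct pivot∈ rank
    (≤-trans (≤-reflexive (≡.sym (+-identityʳ (c + length xs)))) (budget (inj₁ z≤n) z≤n))
    (λ n≤3 → contradiction n≤3 (<⇒≱ 4≤n)) (λ _ → m≤n+m (length xs) c)
    where open GoodPivot good

  lower-answer : ∀ {xs m c i r t} → GoodPivot xs m c → 4 ≤ length xs →
                 Correct (filter (_<? m) xs) i (just (r , t)) → Correct xs i (just (r , c + length xs + t))
  lower-answer {xs} {m} {c} {i} {r} {t} good 4≤n (correct r∈lower rank t≤ _ _) =
    correct (proj₁ r∈xs×r≺m) rank′ (budget (inj₁ ≤-refl) t≤) (λ n≤3 → contradiction n≤3 (<⇒≱ 4≤n))
            (λ _ → ≤-trans (m≤n+m (length xs) c) (m≤m+n (c + length xs) t))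
    where
    open GoodPivot good
    r∈xs×r≺m : r ∈ xs × r ≺ m
    r∈xs×r≺m = ∈-filter⁻ Eq.setoid (_<? m) (λ x≈y x≺m → <-respˡ-≈ x≈y x≺m) r∈lower
    same : (λ x → x ≺ m × x ≺ r) ≐ (_≺ r)
    same = proj₂ , λ x≺r → ≺-trans x≺r (proj₂ r∈xs×r≺m) , x≺r
    rank′ : count (_<? r) xs ≡ i ∸ 1
    rank′ = begin
      count (_<? r) xs                   ≡⟨ cong length (filter-≐ ((_<? m) ∩? (_<? r)) (_<? r) same xs) ⟨
      count ((_<? m) ∩? (_<? r)) xs      ≡⟨ count-filter (_<? r) (_<? m) xs ⟨
      count (_<? r) (filter (_<? m) xs)  ≡⟨ rank ⟩
      i ∸ 1                              ∎
      where open ≡-Reasoning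

  below-split : ∀ {m r} → m ≺ r → ∀ x → 𝟙 (x ≼? m) + 𝟙 (((_≻? m) ∩? (_<? r)) x) ≡ 𝟙 (x <? r)
  below-split {m} {r} m≺r x with compare x m
  ... | tri< x≺m _ _ = ≡.sym (𝟙-yes (x <? r) (≺-trans x≺m m≺r))
  ... | tri≈ _ x≈m _ = ≡.sym (𝟙-yes (x <? r) (<-respˡ-≈ (Eq.sym x≈m) m≺r))
  ... | tri> _ _ _   = refl

  upper-answer : ∀ {xs m c i j r t} → GoodPivot xs m c → 4 ≤ length xs →
                 count (_<? m) xs + 1 + (j ∸ 1) ≡ i ∸ 1 →
                 Correct (filter (_≻? m) xs) j (just (r , t)) → Correct xs i (just (r , c + length xs + t))
  upper-answer {xs} {m} {c} {i} {j} {r} {t} good 4≤n shift (correct r∈upper rank t≤ _ _) =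
    correct (proj₁ r∈xs×m≺r) rank′ (budget (inj₂ ≤-refl) t≤) (λ n≤3 → contradiction n≤3 (<⇒≱ 4≤n))
            (λ _ → ≤-trans (m≤n+m (length xs) c) (m≤m+n (c + length xs) t))
    where
    open GoodPivot good
    open ≡-Reasoning
    r∈xs×m≺r : r ∈ xs × m ≺ r
    r∈xs×m≺r = ∈-filter⁻ Eq.setoid (_≻? m) (λ x≈y m≺x → <-respʳ-≈ x≈y m≺x) r∈upper
    rank′ : count (_<? r) xs ≡ i ∸ 1
    rank′ = begin
      count (_<? r) xs
        ≡⟨ count-+ (_≼? m) ((_≻? m) ∩? (_<? r)) (_<? r) (below-split (proj₂ r∈xs×m≺r)) xs ⟨
      count (_≼? m) xs + count ((_≻? m) ∩? (_<? r)) xs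
        ≡⟨ cong₂ _+_ at-most (≡.sym (count-filter (_<? r) (_≻? m) xs)) ⟩
      count (_<? m) xs + 1 + count (_<? r) (filter (_≻? m) xs)
        ≡⟨ cong (count (_<? m) xs + 1 +_) rank ⟩
      count (_<? m) xs + 1 + (j ∸ 1)
        ≡⟨ shift ⟩
      i ∸ 1 ∎

  Sound : ℕ → Set
  Sound f = ∀ ys j → length ys ≤ f → Unique Eq.setoid ys → 1 ≤ j → j ≤ length ys →
            Correct ys j (selectF f ys j)

  median-call : ∀ {xs M M′ k₁ k₂ f} → Medians xs M k₁ → Medians M M′ k₂ → 4 ≤ length xs →
                length xs ≤ suc f → length M′ ≤ f × 1 ≤ ⌈ length M′ /2⌉
  median-call R R′ 4≤n fuel =
    ≤-pred (≤-trans (s≤s (medians-shorter R′)) (≤-trans (medians-shrink R (≤-trans (s≤s (s≤s z≤n)) 4≤n)) fuel)) ,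
    ⌈n/2⌉-mono (medians-nonempty R′ (medians-nonempty R (≤-trans (s≤s z≤n) 4≤n)))

  select-large : ∀ f xs i → 4 ≤ length xs → length xs ≤ suc f → Unique Eq.setoid xs →
                 1 ≤ i → i ≤ length xs → Sound f → Correct xs i (selectF (suc f) xs i)
  select-large f xs i 4≤n fuel u 1≤i i≤n IH with length xs ≤ᵇ 3 | ≤ᵇ⇒≤ (length xs) 3
  ... | true  | small = contradiction (small tt) (<⇒≱ 4≤n)
  ... | false | _ with medians xs | medians-spec xs
  ... | (M , _) | R with medians M | medians-spec M
  ... | (M′ , _) | R′ with selectF f M′ ⌈ length M′ /2⌉
                        | IH M′ ⌈ length M′ /2⌉ (proj₁ (median-call R R′ 4≤n fuel))
                             (medians-unique R′ (medians-unique R u)) (proj₂ (median-call R R′ 4≤n fuel))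
                             (⌈n/2⌉≤n (length M′))
  ... | ._ | median@(correct {m} _ _ _ _ _) with partition m xs | partition-spec m xs
  ... | ._ | refl with <-cmp (count (_<? m) xs) (i ∸ 1) | pivot-is-good u 4≤n R R′ median
  ... | tri≈ _ rank _ | good = pivot-answer good 4≤n rank
  ... | tri> _ _ more | good with selectF f (filter (_<? m) xs) i
                                | IH (filter (_<? m) xs) i (≤-pred (≤-trans (GoodPivot.lower< good) fuel))
                                     (filter⁺ Eq.setoid (_<? m) u) 1≤i (lower-index 1≤i more)
  ...   | ._ | answer@(correct _ _ _ _ _) = lower-answer good 4≤n answer
  select-large f xs i 4≤n fuel u 1≤i i≤n IH | false | _ | (M , _) | R | (M′ , _) | R′
    | ._ | correct {m} _ _ _ _ _ | ._ | refl | tri< less _ _ | good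
    with upper-index (count (_<? m) xs) i (count (_≻? m) xs) less
                     (≤-trans i≤n (≤-reflexive (≡.sym (GoodPivot.sizes good))))
  ... | 1≤j , j≤b , shift with selectF f (filter (_≻? m) xs) (i ∸ count (_<? m) xs ∸ 1)
                            | IH (filter (_≻? m) xs) (i ∸ count (_<? m) xs ∸ 1)
                                 (≤-pred (≤-trans (GoodPivot.upper< good) fuel))
                                 (filter⁺ Eq.setoid (_≻? m) u) 1≤j j≤b
  ...   | ._ | answer@(correct _ _ _ _ _) = upper-answer good 4≤n shift answer

  select-sound : ∀ f → Sound f
  select-sound zero    ys j ys≤0 _ 1≤j j≤n = contradiction (≤-trans 1≤j (≤-trans j≤n ys≤0)) λ ()
  select-sound (suc f) ys j fuel u 1≤j j≤n with length ys ≤? 3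
  ... | yes n≤3 = select-small f ys j n≤3 u 1≤j j≤n
  ... | no  n≰3 = select-large f ys j (≰⇒> n≰3) fuel u 1≤j j≤n (select-sound f)

  selection : ∀ xs → Unique Eq.setoid xs → ∀ i → 1 ≤ i → i ≤ length xs →
              Σ C λ r → Σ ℕ λ t → select O xs i ≡ just (r , t) × r ∈ xs × count (_<? r) xs ≡ i ∸ 1
                × t ≤ 108 * length xs × (4 ≤ length xs → length xs ≤ 1 * t)
  selection xs u i 1≤i i≤n with select O xs i | select-sound (length xs) xs i ≤-refl u 1≤i i≤n
  ... | ._ | correct {r} {t} r∈xs rank linear _ partitioned =
    r , t , refl , r∈xs , rank , linear , λ 4≤n → ≤-trans (partitioned 4≤n) (≤-reflexive (≡.sym (*-identityˡ t)))

open Membership using (_∈_)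

lemma1 : Σ ℕ λ c → Σ ℕ λ d → Σ ℕ λ N →
    (O : StrictTotalOrder 0ℓ 0ℓ 0ℓ) →
    let open StrictTotalOrder O in
    (xs : List Carrier) → Unique Eq.setoid xs →
    (i : ℕ) → 1 ≤ i → i ≤ length xs →
    Σ Carrier λ r → Σ ℕ λ t →
      select O xs i ≡ just (r , t)
      × _∈_ Eq.setoid r xs
      × length (filter (_<? r) xs) ≡ i ∸ 1
      × t ≤ c * length xs
      × (N ≤ length xs → length xs ≤ d * t)
lemma1 = 108 , 1 , 4 , λ O → Analysis.selection O
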